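{- Let $C$ be a set and $\prec$ a Lehmann hyper-order on $C$. Then $\prec$ is transitive: if $A\prec B$ and $B\prec D$ then $A\prec D$.
   Context: A hyper-relation on $C$ is a binary relation $\prec$ on the set of subsets of $C$. A set $B\subseteq C$ is essential if $\emptyset\prec B$ and insignificant otherwise. A Lehmann hyper-order is a hyper-relation satisfying: (L0) irreflexivity; (L1) if $A'\subseteq A\prec B$ then $A'\prec B$; (L2) if $(A_i)_{i\in I}$ is a nonempty family with $A_i\prec B$ for all $i$, then $\bigcup_iA_i\prec B$; (L3) if $A\prec B\subseteq B'$ then $A\prec B'$; (L4) if $A\prec A\cup B$ then $A\prec B$; (L5) if $A$ is essential and $B$ is insignificant then $B\prec A$. -}

module Defs where

open import Level using (0ℓ)
open import Data.Product using (Σ; _,_; ∃)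
open import Relation.Nullary using (¬_)
open import Relation.Unary using (Pred; _⊆_; _∪_; ∅)

Subset : Set → Set₁
Subset C = Pred C 0ℓ

HyperRel : Set → Set₁
HyperRel C = Subset C → Subset C → Set

⋃ : {C I : Set} → (I → Subset C) → Subset C
⋃ {I = I} A x = Σ I (λ i → A i x)

Essential : {C : Set} → HyperRel C → Subset C → Set
Essential _≺_ B = ∅ ≺ B

Insignificant : {C : Set} → HyperRel C → Subset C → Set
Insignificant _≺_ B = ¬ (∅ ≺ B)

record IsLehmann {C : Set} (_≺_ : HyperRel C) : Set₁ where
  field
    L0 : ∀ A → ¬ (A ≺ A)
    L1 : ∀ {A' A B} → A' ⊆ A → A ≺ B → A' ≺ B
    L2 : ∀ {I : Set} (A : I → Subset C) {B} → I → (∀ i → A i ≺ B) → ⋃ A ≺ B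
    L3 : ∀ {A B B'} → A ≺ B → B ⊆ B' → A ≺ B'
    L4 : ∀ {A B} → A ≺ (A ∪ B) → A ≺ B
    L5 : ∀ {A B} → Essential _≺_ A → Insignificant _≺_ B → B ≺ A

{-# OPTIONS --safe #-}
module Submission where

-- A ∪ B lies below B ∪ D by (L2) and (L3); since B ∪ D ⊆ (A ∪ B) ∪ D, rule (L4)
-- strips the left side off the right and gives A ∪ B ≺ D, hence A ≺ D by (L1).

open import Defs
open import Data.Bool using (Bool; true; false)
open import Data.Product using (_,_)
open import Data.Sum using (inj₁; inj₂; [_,_])
open import Relation.Unary using (_∪_; _⊆_)

module _ {C : Set} {_≺_ : HyperRel C} (L : IsLehmann _≺_) where
  open IsLehmann L

  ∪-≺ : ∀ {A A' B} → A ≺ B → A' ≺ B → (A ∪ A') ≺ B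
  ∪-≺ {A} {A'} {B} A≺B A'≺B =
    L1 [ (λ a → true , a) , (λ a' → false , a') ] (L2 pair true below)
    where
    pair : Bool → Subset C
    pair true  = A
    pair false = A'

    below : ∀ i → pair i ≺ B
    below true  = A≺B
    below false = A'≺B

  ≺-trans : ∀ {A B D} → A ≺ B → B ≺ D → A ≺ D
  ≺-trans {A} {B} {D} A≺B B≺D =
    L1 inj₁ (L4 (L3 (∪-≺ (L3 A≺B inj₁) (L3 B≺D inj₂)) B∪D⊆A∪B∪D))
    where
    B∪D⊆A∪B∪D : B ∪ D ⊆ (A ∪ B) ∪ D
    B∪D⊆A∪B∪D = [ (λ b → inj₁ (inj₂ b)) , inj₂ ]

lemmaA1 : {C : Set} (_≺_ : HyperRel C) → IsLehmann _≺_ →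
    ∀ {A B D} → A ≺ B → B ≺ D → A ≺ D
lemmaA1 _≺_ L = ≺-trans L
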